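{- Let $f\colon\mathbb{B}^n\to\mathbb{B}^n$ be a Boolean network with set of components $V$, let $v\in V$ be such that there is no positive loop at $v$ in $G(f)$, and let $\tilde f$ be the network obtained by eliminating $v$ (with $\mathcal{R}^0,\mathcal{R}^1,\mathcal{S}^0,\mathcal{S}^1,\pi$ as in the context). Then: (i) if $x\in\mathbb{B}^n$ is a fixed point for $f$, then $x=\mathcal{R}^0(x)=\mathcal{R}^1(x)$, $\pi(x)$ is a fixed point for $\tilde f$, and no other fixed point for $f$ is projected on $\pi(x)$; (ii) if $\{x,\bar{x}^v\}$ is a cyclic attractor of $AD(f)$, then $\pi(x)$ is a fixed point for $\tilde f$; (iii) if $x\in\mathbb{B}^{n-1}$ is a fixed point for $\tilde f$, then $\{\mathcal{S}^0(x),\mathcal{S}^1(x)\}$ is an attractor of $AD(f)$; (iv) if $T\subseteq\mathbb{B}^n$ is a trap set for $f$, then $\pi(T)$ is a trap set for $\tilde f$; (v) if $\{x,\bar{x}^i\}$ is a cyclic attractor of $AD(f)$ for some $x\in\mathbb{B}^n$ and $i\neq v$, then $\{\pi(x),\pi(\bar{x}^i)\}$ is a cyclic attractor of $AD(\tilde f)$; (vi) if $\tilde A\subseteq\mathbb{B}^{n-1}$ is an attractor of $AD(\tilde f)$, there exists at most one attractor of $AD(f)$ intersecting $\pi^{ -1}(\tilde A)$.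
   Context: $\mathbb{B}=\{0,1\}$. A Boolean network is a map $f\colon\mathbb{B}^n\to\mathbb{B}^n$ with set of components $V=\{1,\dots,n\}$. For $x\in\mathbb{B}^n$ and $I\subseteq V$, $\bar{x}^I$ flips exactly the components in $I$; $\bar{x}^i=\bar{x}^{\{i\}}$; $x^{i=a}$ is $x$ with $i$-th component set to $a$. The asynchronous dynamics $AD(f)$ is the directed graph on $\mathbb{B}^n$ with a transition $x\to\bar{x}^i$ iff $f_i(x)\neq x_i$. The interaction graph $G(f)$ is the signed multidigraph on $V$ with an edge $j\to i$ of sign $s\in\{ -1,1\}$ iff $s=(f_i(\bar{x}^j)-f_i(x))(\bar{x}^j_j-x_j)$ for some $x\in\mathbb{B}^n$; a positive loop at $v$ is an edge $v\to v$ of sign $+1$. A trap set is a set $T$ of states such that every transition from a state of $T$ ends in $T$; attractors are the minimal (w.r.t. inclusion) nonempty trap sets; an attractor is a fixed point (identified with its unique state $x$, i.e. $f(x)=x$) if it has one state, cyclic otherwise. Elimination of $v$ (no positive loop at $v$): for $a\in\{0,1\}$, $\mathcal{R}^a(x)=(x_1,\dots,x_{v-1},f_v(x^{v=a}),x_{v+1},\dots,x_n)$; $\pi\colon\mathbb{B}^n\to\mathbb{B}^{n-1}$ is the projection onto components $V\setminus\{v\}$ (which index $\mathbb{B}^{n-1}$); $\mathcal{S}^a\colon\mathbb{B}^{n-1}\to\mathbb{B}^n$ is the unique map with $\mathcal{S}^a\circ\pi=\mathcal{R}^a$; $\tilde f\colon\mathbb{B}^{n-1}\to\mathbb{B}^{n-1}$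 is given for $i\neq v$ by $\tilde f_i(x)=f_i(\mathcal{S}^0(x))\wedge f_i(\mathcal{S}^1(x))$ if $x_i=1$ and $\tilde f_i(x)=f_i(\mathcal{S}^0(x))\vee f_i(\mathcal{S}^1(x))$ if $x_i=0$. -}

module Defs where

open import Data.Bool using (Bool; true; false; not; _∧_; _∨_; if_then_else_)
open import Data.Nat using (ℕ; suc)
open import Data.Fin using (Fin; punchIn)
open import Data.Vec using (Vec; lookup; tabulate; updateAt; insertAt; removeAt; _[_]≔_)
open import Data.Integer using (ℤ; 1ℤ; -1ℤ; _-_; _*_; +_)
open import Data.Product using (Σ; ∃; _×_; _,_)
open import Data.Sum using (_⊎_)
open import Level using (0ℓ)
open import Relation.Unary using (Pred; _⊆_; _≐_)
open import Relation.Nullary using (¬_)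
open import Relation.Binary.PropositionalEquality using (_≡_; _≢_)

State : ℕ → Set
State n = Vec Bool n

BN : ℕ → Set
BN n = State n → State n

StateSet : ℕ → Set₁
StateSet n = Pred (State n) 0ℓ

flip : ∀ {n} → State n → Fin n → State n
flip x i = updateAt x i not

toℤ : Bool → ℤ
toℤ false = + 0
toℤ true  = + 1

-- edge j → i of sign s in the interaction graph G(f)
Edge : ∀ {n} → BN n → Fin n → Fin n → ℤ → Set
Edge {n} f j i s =
  (s ≡ 1ℤ ⊎ s ≡ -1ℤ) ×
  ∃ λ (x : State n) →
    s ≡ (toℤ (lookup (f (flip x j)) i) - toℤ (lookup (f x) i))
        * (toℤ (lookup (flip x j) j) - toℤ (lookup x j))

PositiveLoop : ∀ {n} → BN n → Fin n → Set
PositiveLoop f v = Edge f v v 1ℤ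

Trans : ∀ {n} → BN n → State n → State n → Set
Trans f x y = ∃ λ i → (lookup (f x) i ≢ lookup x i) × (y ≡ flip x i)

FixedPoint : ∀ {n} → BN n → State n → Set
FixedPoint f x = f x ≡ x

TrapSet : ∀ {n} → BN n → StateSet n → Set
TrapSet f T = ∀ x y → T x → Trans f x y → T y

Nonempty : ∀ {n} → StateSet n → Set
Nonempty A = ∃ λ x → A x

Attractor : ∀ {n} → BN n → StateSet n → Set₁
Attractor f A =
  TrapSet f A × Nonempty A ×
  (∀ (B : StateSet _) → B ⊆ A → TrapSet f B → Nonempty B → A ⊆ B)

Singleton : ∀ {n} → State n → StateSet n
Singleton x = λ y → y ≡ x

Pair : ∀ {n} → State n → State n → StateSet n
Pair x y = λ z → z ≡ x ⊎ z ≡ y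

CyclicAttractor : ∀ {n} → BN n → StateSet n → Set₁
CyclicAttractor f A = Attractor f A × ¬ (∃ λ x → A ≐ Singleton x)

Image : ∀ {m n} → (State n → State m) → StateSet n → StateSet m
Image g T = λ y → ∃ λ x → T x × g x ≡ y

Preimage : ∀ {m n} → (State n → State m) → StateSet m → StateSet n
Preimage g A = λ x → A (g x)

Intersects : ∀ {n} → StateSet n → StateSet n → Set
Intersects A B = ∃ λ x → A x × B x

-- Elimination of v, for n = suc m.  Components of 𝔹^{n-1} are indexed
-- by Fin m; index i corresponds to component (punchIn v i) of V.

π : ∀ {m} → Fin (suc m) → State (suc m) → State m
π v x = removeAt x v

R : ∀ {m} → BN (suc m) → Fin (suc m) → Bool → State (suc m) → State (suc m)
R f v a x = x [ v ]≔ lookup (f (x [ v ]≔ a)) v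

-- 𝓢^a : the map with 𝓢^a ∘ π = 𝓡^a (𝓡^a does not depend on x_v,
-- so we evaluate 𝓡^a on any lift of y, here the one with x_v = a)
S : ∀ {m} → BN (suc m) → Fin (suc m) → Bool → State m → State (suc m)
S f v a y = R f v a (insertAt y v a)

elim : ∀ {m} → BN (suc m) → Fin (suc m) → BN m
elim f v y = tabulate λ i →
  let i' = punchIn v i
      b0 = lookup (f (S f v false y)) i'
      b1 = lookup (f (S f v true  y)) i'
  in if lookup y i then b0 ∧ b1 else b0 ∨ b1

{-# OPTIONS --safe #-}
-- Write a state as (y, c) with y = π x and c = x_v. Without a positive loop at v, c ↦ f_v(y, c)
-- is constant or negation, so every trap set meeting the fibre over y contains 𝓢⁰(y) and 𝓢¹(y),
-- and from 𝓢ᵃ(y) the only possible v-move leads to another 𝓢ᵇ(y). By construction f̃ᵢ(y) ≠ yᵢ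
-- iff fᵢ moves component i at 𝓢⁰(y) or at 𝓢¹(y), so every transition of f̃ is the projection of a
-- transition of f; where v is stable at (y, c) the two dynamics agree exactly.
module Submission where

open import Defs
open import Data.Bool using (Bool; true; false; not; _∧_; _∨_; if_then_else_)
open import Data.Bool.Properties using (_≟_; ¬-not; not-¬)
open import Data.Nat using (ℕ; suc)
open import Data.Fin using (Fin; punchIn; punchOut) renaming (_≟_ to _≟ᶠ_)
open import Data.Fin.Properties using (¬∀⟶∃¬; punchIn-punchOut)
open import Data.Vec using (Vec; _∷_; lookup; updateAt; insertAt; _[_]≔_)
open import Data.Vec.Properties
  using (lookup∘updateAt; insertAt-lookup; insertAt-punchIn; removeAt-insertAt; insertAt-removeAt;
         lookup∘tabulate; tabulate∘lookup; tabulate-cong)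
open import Data.Integer using (1ℤ; _-_; _*_)
open import Data.Product using (∃; _×_; _,_; proj₁; proj₂)
open import Data.Sum using (_⊎_; inj₁; inj₂; swap) renaming (map to map⊎)
open import Function using (_∘_)
open import Relation.Unary using (_≐_; _⊆_)
open import Relation.Nullary using (¬_; yes; no; contradiction)
open import Relation.Binary.Construct.Closure.ReflexiveTransitive using (Star; ε; _◅_; _◅◅_)
open import Relation.Binary.PropositionalEquality
  using (_≡_; _≢_; refl; sym; trans; cong; cong₂; subst; subst₂; module ≡-Reasoning)

merge : Bool → Bool → Bool → Bool
merge b b₀ b₁ = if b then b₀ ∧ b₁ else b₀ ∨ b₁

merge-idem : ∀ b c → merge b c c ≡ c
merge-idem false false = refl
merge-idem false true  = refl
merge-idem true  false = refl
merge-idem true  true  = refl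

merge-≡⁻ : ∀ b b₀ b₁ → merge b b₀ b₁ ≡ b → b₀ ≡ b × b₁ ≡ b
merge-≡⁻ false false false _ = refl , refl
merge-≡⁻ true  true  true  _ = refl , refl
merge-≡⁻ false false true  ()
merge-≡⁻ false true  _     ()
merge-≡⁻ true  false _     ()
merge-≡⁻ true  true  false ()

merge-≢ : ∀ b b₀ b₁ → merge b b₀ b₁ ≢ b → b₀ ≢ b ⊎ b₁ ≢ b
merge-≢ b b₀ b₁ moved with b₀ ≟ b | b₁ ≟ b
... | yes refl | yes refl = contradiction (merge-idem b b) moved
... | no b₀≢b  | _        = inj₁ b₀≢b
... | yes _    | no b₁≢b  = inj₂ b₁≢b

both-values : ∀ {p} {P : Bool → Set p} {c} → P c → P (not c) → ∀ b → P b
both-values {P = P} {c} Pc Pnc b with b ≟ c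
... | yes refl = Pc
... | no b≢c   = subst P (sym (¬-not b≢c)) Pnc

updateAt-insertAt : ∀ {A : Set} {n} (xs : Vec A n) i x (g : A → A) →
                    updateAt (insertAt xs i x) i g ≡ insertAt xs i (g x)
updateAt-insertAt xs       Fin.zero    x g = refl
updateAt-insertAt (y ∷ xs) (Fin.suc i) x g = cong (y ∷_) (updateAt-insertAt xs i x g)

updateAt-insertAt-punchIn : ∀ {A : Set} {n} (xs : Vec A n) i x j (g : A → A) →
                            updateAt (insertAt xs i x) (punchIn i j) g ≡ insertAt (updateAt xs j g) i x
updateAt-insertAt-punchIn xs       Fin.zero    x j           g = refl
updateAt-insertAt-punchIn (y ∷ xs) (Fin.suc i) x Fin.zero    g = refl
updateAt-insertAt-punchIn (y ∷ xs) (Fin.suc i) x (Fin.suc j) g =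
  cong (y ∷_) (updateAt-insertAt-punchIn xs i x j g)

pointwise⇒≡ : ∀ {n} {x y : State n} → (∀ i → lookup x i ≡ lookup y i) → x ≡ y
pointwise⇒≡ {x = x} {y} eq = trans (sym (tabulate∘lookup x)) (trans (tabulate-cong eq) (tabulate∘lookup y))

flip-≢ : ∀ {n} (x : State n) i → flip x i ≢ x
flip-≢ x i eq = not-¬ refl (trans (cong (λ z → lookup z i) (sym eq)) (lookup∘updateAt i x))

module _ {n} {F : BN n} where

  trap-closed : ∀ {T : StateSet n} {x y} → TrapSet F T → T x → Star (Trans F) x y → T y
  trap-closed trT Tx ε       = Tx
  trap-closed trT Tx (t ◅ r) = trap-closed trT (trT _ _ Tx t) r

  attractor-connected : ∀ {A : StateSet n} {x y} → Attractor F A → A x → A y → Star (Trans F) x y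
  attractor-connected {x = x} (trA , _ , minA) Ax Ay =
    minA (Star (Trans F) x) (trap-closed trA Ax) (λ _ _ r t → r ◅◅ (t ◅ ε)) (x , ε) Ay

  pair-attractor : ∀ {a b} → TrapSet F (Pair a b) → Star (Trans F) a b → Star (Trans F) b a →
                   Attractor F (Pair a b)
  pair-attractor {a} {b} trP a↝b b↝a = trP , (a , inj₁ refl) , minimal
    where
    minimal : ∀ (B : StateSet n) → B ⊆ Pair a b → TrapSet F B → Nonempty B → Pair a b ⊆ B
    minimal B B⊆P trB (w , Bw) with B⊆P Bw
    ... | inj₁ refl = λ { (inj₁ refl) → Bw ; (inj₂ refl) → trap-closed trB Bw a↝b }
    ... | inj₂ refl = λ { (inj₁ refl) → trap-closed trB Bw b↝a ; (inj₂ refl) → Bw }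

  -- In a two-state attractor a cannot be a fixed point, and its successors stay in {a, b}.
  attractor-pair-step : ∀ {A : StateSet n} {a b} → Attractor F A → A ⊆ Pair a b → A a → A b → a ≢ b →
                        Trans F a b
  attractor-pair-step {a = a} {b} (trA , _ , minA) A⊆ab Aa Ab a≢b =
    step (¬∀⟶∃¬ n (λ i → lookup (F a) i ≡ lookup a i) (λ i → lookup (F a) i ≟ lookup a i) a-moves)
    where
    a-moves : ¬ (∀ i → lookup (F a) i ≡ lookup a i)
    a-moves fixed = a≢b (sym (minA (Singleton a) (λ { refl → Aa }) singleton-trap (a , refl) Ab))
      where
      singleton-trap : TrapSet F (Singleton a)
      singleton-trap _ _ refl (i , moved , _) = contradiction (fixed i) moved
    step : ∃ (λ i → lookup (F a) i ≢ lookup a i) → Trans F a b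
    step (i , moved) with A⊆ab (trA a _ Aa (i , moved , refl))
    ... | inj₁ flip≡a = contradiction flip≡a (flip-≢ a i)
    ... | inj₂ flip≡b = i , moved , sym flip≡b

  attractors-meeting⇒⊆ : ∀ {A B : StateSet n} {z} → Attractor F A → Attractor F B → A z → B z → A ⊆ B
  attractors-meeting⇒⊆ {A} {B} {z} (trA , _ , minA) (trB , _ , _) Az Bz =
    proj₂ ∘ minA (λ w → A w × B w) proj₁ (λ w w′ (Aw , Bw) t → trA w w′ Aw t , trB w w′ Bw t) (z , Az , Bz)

module Coordinates {m} (v : Fin (suc m)) where

  lift : State m → Bool → State (suc m)
  lift y c = insertAt y v c

  data Lifted : State (suc m) → Set where
    lifted : ∀ y c → Lifted (lift y c)

  lift-view : ∀ x → Lifted x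
  lift-view x = subst Lifted (insertAt-removeAt x v) (lifted (π v x) (lookup x v))

  component-view : ∀ j → j ≡ v ⊎ ∃ λ k → j ≡ punchIn v k
  component-view j with v ≟ᶠ j
  ... | yes v≡j = inj₁ (sym v≡j)
  ... | no v≢j  = inj₂ (punchOut v≢j , sym (punchIn-punchOut v≢j))

  π-lift : ∀ y c → π v (lift y c) ≡ y
  π-lift y c = removeAt-insertAt y v c

  lift-injective : ∀ {y y′ c c′} → lift y c ≡ lift y′ c′ → y ≡ y′ × c ≡ c′
  lift-injective {y} {y′} {c} {c′} eq =
    trans (sym (π-lift y c)) (trans (cong (π v) eq) (π-lift y′ c′)) ,
    trans (sym (insertAt-lookup y v c)) (trans (cong (λ z → lookup z v) eq) (insertAt-lookup y′ v c′))

  flip-lift-v : ∀ y c → flip (lift y c) v ≡ lift y (not c)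
  flip-lift-v y c = updateAt-insertAt y v c not

  flip-lift-punchIn : ∀ y c k → flip (lift y c) (punchIn v k) ≡ lift (flip y k) c
  flip-lift-punchIn y c k = updateAt-insertAt-punchIn y v c k not

  set-lift-v : ∀ y c a → lift y c [ v ]≔ a ≡ lift y a
  set-lift-v y c a = updateAt-insertAt y v c (λ _ → a)

module Elimination {m} (f : BN (suc m)) (v : Fin (suc m)) (noLoop : ¬ PositiveLoop f v) where

  open Coordinates v

  fᵥ : State m → Bool → Bool
  fᵥ y c = lookup (f (lift y c)) v

  fᵢ : State m → Bool → Fin m → Bool
  fᵢ y c k = lookup (f (lift y c)) (punchIn v k)

  fᵥ-not-identity : ∀ {y} → fᵥ y false ≡ false → fᵥ y true ≢ true
  fᵥ-not-identity {y} f₀ f₁ = noLoop (inj₁ refl , lift y false , edge)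
    where
    edge : 1ℤ ≡ (toℤ (lookup (f (flip (lift y false) v)) v) - toℤ (lookup (f (lift y false)) v))
                 * (toℤ (lookup (flip (lift y false) v) v) - toℤ (lookup (lift y false) v))
    edge rewrite flip-lift-v y false | f₀ | f₁ | insertAt-lookup y v true | insertAt-lookup y v false = refl

  fᵥ-fixed⇒constant : ∀ {y c} → fᵥ y c ≡ c → ∀ a → fᵥ y a ≡ c
  fᵥ-fixed⇒constant {y} {false} f₀ false = f₀
  fᵥ-fixed⇒constant {y} {true}  f₁ true  = f₁
  fᵥ-fixed⇒constant {y} {false} f₀ true with fᵥ y true in f₁
  ... | false = refl
  ... | true  = contradiction f₁ (fᵥ-not-identity f₀)
  fᵥ-fixed⇒constant {y} {true}  f₁ false with fᵥ y false in f₀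
  ... | true  = refl
  ... | false = contradiction f₁ (fᵥ-not-identity f₀)

  R-lift : ∀ y c a → R f v a (lift y c) ≡ lift y (fᵥ y a)
  R-lift y c a = begin
    lift y c [ v ]≔ lookup (f (lift y c [ v ]≔ a)) v ≡⟨ cong (λ z → lift y c [ v ]≔ lookup (f z) v) (set-lift-v y c a) ⟩
    lift y c [ v ]≔ fᵥ y a                           ≡⟨ set-lift-v y c (fᵥ y a) ⟩
    lift y (fᵥ y a)                                  ∎
    where open ≡-Reasoning

  S-lift : ∀ a y → S f v a y ≡ lift y (fᵥ y a)
  S-lift a y = R-lift y a a

  v-step : ∀ {y c} → fᵥ y c ≢ c → Trans f (lift y c) (lift y (not c))
  v-step {y} {c} moved = v , moved ∘ (λ e → trans e (insertAt-lookup y v c)) , sym (flip-lift-v y c)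

  punchIn-step : ∀ {y c k} → fᵢ y c k ≢ lookup y k → Trans f (lift y c) (lift (flip y k) c)
  punchIn-step {y} {c} {k} moved =
    punchIn v k , moved ∘ (λ e → trans e (insertAt-punchIn y v c k)) , sym (flip-lift-punchIn y c k)

  step-from-lift : ∀ {y c z} → Trans f (lift y c) z →
    (fᵥ y c ≢ c × z ≡ lift y (not c)) ⊎ (∃ λ k → fᵢ y c k ≢ lookup y k × z ≡ lift (flip y k) c)
  step-from-lift {y} {c} (j , moved , refl) with component-view j
  ... | inj₁ refl = inj₁ (moved ∘ (λ e → trans e (sym (insertAt-lookup y v c))) , flip-lift-v y c)
  ... | inj₂ (k , refl) =
    inj₂ (k , moved ∘ (λ e → trans e (sym (insertAt-punchIn y v c k))) , flip-lift-punchIn y c k)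

  lookup-elim : ∀ y k → lookup (elim f v y) k ≡ merge (lookup y k) (fᵢ y (fᵥ y false) k) (fᵢ y (fᵥ y true) k)
  lookup-elim y k = trans (lookup∘tabulate _ k)
    (cong₂ (merge (lookup y k)) (cong (λ z → lookup (f z) (punchIn v k)) (S-lift false y))
                                (cong (λ z → lookup (f z) (punchIn v k)) (S-lift true y)))

  elim-fixedPoint : ∀ {y} → (∀ a k → fᵢ y (fᵥ y a) k ≡ lookup y k) → FixedPoint (elim f v) y
  elim-fixedPoint {y} fixes = pointwise⇒≡ λ k → begin
    lookup (elim f v y) k                                              ≡⟨ lookup-elim y k ⟩
    merge (lookup y k) (fᵢ y (fᵥ y false) k) (fᵢ y (fᵥ y true) k)       ≡⟨ cong₂ (merge (lookup y k)) (fixes false k) (fixes true k) ⟩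
    merge (lookup y k) (lookup y k) (lookup y k)                       ≡⟨ merge-idem (lookup y k) (lookup y k) ⟩
    lookup y k                                                         ∎
    where open ≡-Reasoning

  elim-fixedPoint⁻ : ∀ {y} → FixedPoint (elim f v) y → ∀ a k → fᵢ y (fᵥ y a) k ≡ lookup y k
  elim-fixedPoint⁻ {y} fixed a k
    with merge-≡⁻ (lookup y k) (fᵢ y (fᵥ y false) k) (fᵢ y (fᵥ y true) k)
                  (trans (sym (lookup-elim y k)) (cong (λ z → lookup z k) fixed))
  elim-fixedPoint⁻ fixed false k | f₀ , _ = f₀
  elim-fixedPoint⁻ fixed true  k | _ , f₁ = f₁

  lookup-elim-stable : ∀ {w c} → fᵥ w c ≡ c → ∀ k → lookup (elim f v w) k ≡ fᵢ w c k
  lookup-elim-stable {w} {c} stable k = begin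
    lookup (elim f v w) k                                          ≡⟨ lookup-elim w k ⟩
    merge (lookup w k) (fᵢ w (fᵥ w false) k) (fᵢ w (fᵥ w true) k)   ≡⟨ cong₂ (merge (lookup w k)) (on-c false) (on-c true) ⟩
    merge (lookup w k) (fᵢ w c k) (fᵢ w c k)                       ≡⟨ merge-idem (lookup w k) (fᵢ w c k) ⟩
    fᵢ w c k                                                       ∎
    where
    open ≡-Reasoning
    on-c : ∀ a → fᵢ w (fᵥ w a) k ≡ fᵢ w c k
    on-c a = cong (λ b → fᵢ w b k) (fᵥ-fixed⇒constant stable a)

  elim-step⇒step : ∀ {w c z} → fᵥ w c ≡ c → Trans (elim f v) w z → Trans f (lift w c) (lift z c)
  elim-step⇒step stable (k , moved , refl) = punchIn-step (moved ∘ trans (lookup-elim-stable stable k))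

  step⇒elim-step : ∀ {w c z} → fᵥ w c ≡ c → Trans f (lift w c) (lift z c) → Trans (elim f v) w z
  step⇒elim-step stable t with step-from-lift t
  ... | inj₁ (moved , _) = contradiction stable moved
  ... | inj₂ (k , moved , z≡) =
    k , moved ∘ trans (sym (lookup-elim-stable stable k)) , proj₁ (lift-injective z≡)

  stable-in-trap : ∀ {T : StateSet (suc m)} {w c} → TrapSet f T →
                   (∀ {z b} → T (lift z b) → b ≡ c) → T (lift w c) → fᵥ w c ≡ c
  stable-in-trap {w = w} {c} trT onlyC Tw with fᵥ w c ≟ c
  ... | yes stable = stable
  ... | no moved   = contradiction (sym (onlyC (trT _ _ Tw (v-step moved)))) (not-¬ refl)

  fixed-in-trap : ∀ {T : StateSet (suc m)} {y b} → TrapSet f T →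
                  (∀ {z b′} → T (lift z b′) → z ≡ y) → T (lift y b) → ∀ k → fᵢ y b k ≡ lookup y k
  fixed-in-trap {y = y} {b} trT onlyY Tb k with fᵢ y b k ≟ lookup y k
  ... | yes fixed = fixed
  ... | no moved  = contradiction (onlyY (trT _ _ Tb (punchIn-step moved))) (flip-≢ y k)

  -- If v is stable at x, the absence of a positive loop makes fᵥ constant on the fibre of x;
  -- otherwise x moves to x̄ᵛ and T contains the whole fibre.
  trap-contains-S : ∀ {T : StateSet (suc m)} {x} → TrapSet f T → T x → ∀ a → T (S f v a (π v x))
  trap-contains-S {T} {x} trT Tx a with lift-view x
  ... | lifted y c rewrite π-lift y c | S-lift a y with fᵥ y c ≟ c
  ...   | yes stable = subst T (cong (lift y) (sym (fᵥ-fixed⇒constant stable a))) Tx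
  ...   | no moved   = both-values {P = T ∘ lift y} Tx (trT _ _ Tx (v-step moved)) (fᵥ y a)

  fixedPoint-lift : ∀ {y c} → FixedPoint f (lift y c) → fᵥ y c ≡ c × (∀ k → fᵢ y c k ≡ lookup y k)
  fixedPoint-lift {y} {c} fixed =
    trans (cong (λ z → lookup z v) fixed) (insertAt-lookup y v c) ,
    λ k → trans (cong (λ z → lookup z (punchIn v k)) fixed) (insertAt-punchIn y v c k)

  fixedPoint-projection : ∀ x → FixedPoint f x →
    (x ≡ R f v false x × x ≡ R f v true x) × FixedPoint (elim f v) (π v x) ×
    (∀ x′ → FixedPoint f x′ → π v x′ ≡ π v x → x′ ≡ x)
  fixedPoint-projection x fixed with lift-view x
  ... | lifted y c = (R-fixes false , R-fixes true) , elim-fixes , unique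
    where
    constant : ∀ a → fᵥ y a ≡ c
    constant = fᵥ-fixed⇒constant (proj₁ (fixedPoint-lift fixed))
    R-fixes : ∀ a → lift y c ≡ R f v a (lift y c)
    R-fixes a = sym (trans (R-lift y c a) (cong (lift y) (constant a)))
    elim-fixes : FixedPoint (elim f v) (π v (lift y c))
    elim-fixes rewrite π-lift y c = elim-fixedPoint λ a k →
      trans (cong (λ b → fᵢ y b k) (constant a)) (proj₂ (fixedPoint-lift fixed) k)
    unique : ∀ x′ → FixedPoint f x′ → π v x′ ≡ π v (lift y c) → x′ ≡ lift y c
    unique x′ fixed′ same with lift-view x′
    ... | lifted y′ c′ with trans (sym (π-lift y′ c′)) (trans same (π-lift y c))
    ...   | refl = cong (lift y) (trans (sym (proj₁ (fixedPoint-lift fixed′))) (constant c′))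

  v-cycle⇒elim-fixedPoint : ∀ x → CyclicAttractor f (Pair x (flip x v)) → FixedPoint (elim f v) (π v x)
  v-cycle⇒elim-fixedPoint x ((trP , _) , _) with lift-view x
  ... | lifted y c rewrite π-lift y c | flip-lift-v y c =
    elim-fixedPoint λ a → fixed-in-trap trP over-y (fibre-in-P (fᵥ y a))
    where
    fibre-in-P : ∀ b → Pair (lift y c) (lift y (not c)) (lift y b)
    fibre-in-P = both-values (inj₁ refl) (inj₂ refl)
    over-y : ∀ {z b} → Pair (lift y c) (lift y (not c)) (lift z b) → z ≡ y
    over-y (inj₁ eq) = proj₁ (lift-injective eq)
    over-y (inj₂ eq) = proj₁ (lift-injective eq)

  elim-fixedPoint⇒attractor : ∀ y → FixedPoint (elim f v) y → Attractor f (Pair (S f v false y) (S f v true y))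
  elim-fixedPoint⇒attractor y fixed =
    subst₂ (λ s₀ s₁ → Attractor f (Pair s₀ s₁)) (sym (S-lift false y)) (sym (S-lift true y))
      (pair-attractor {F = f} trap (S-connected false true) (S-connected true false))
    where
    P : StateSet (suc m)
    P = Pair (lift y (fᵥ y false)) (lift y (fᵥ y true))
    S∈P : ∀ a → P (lift y (fᵥ y a))
    S∈P false = inj₁ refl
    S∈P true  = inj₂ refl
    -- The only way out of S^a(y) is along v, to S^b(y) with b = fᵥ y a.
    from-S : ∀ a {z} → Trans f (lift y (fᵥ y a)) z → P z
    from-S a t with step-from-lift t
    ... | inj₁ (moved , refl)    = subst P (cong (lift y) (¬-not moved)) (S∈P (fᵥ y a))
    ... | inj₂ (k , moved , _)   = contradiction (elim-fixedPoint⁻ fixed a k) moved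
    trap : TrapSet f P
    trap _ _ (inj₁ refl) = from-S false
    trap _ _ (inj₂ refl) = from-S true
    S-connected : ∀ a a′ → Star (Trans f) (lift y (fᵥ y a)) (lift y (fᵥ y a′))
    S-connected a a′ with fᵥ y a ≟ fᵥ y a′
    ... | yes same  = subst (Star (Trans f) _) (cong (lift y) same) ε
    ... | no differ = subst (Trans f _) (cong (lift y) (sym (¬-not (differ ∘ sym)))) (v-step moves) ◅ ε
      where
      moves : fᵥ y (fᵥ y a) ≢ fᵥ y a
      moves stable = differ (sym (fᵥ-fixed⇒constant stable a′))

  step-image : ∀ {T : StateSet (suc m)} {x} → TrapSet f T → T x → ∀ a {k} →
               fᵢ (π v x) (fᵥ (π v x) a) k ≢ lookup (π v x) k → Image (π v) T (flip (π v x) k)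
  step-image {T} {x} trT Tx a {k} moved =
    lift (flip (π v x) k) (fᵥ (π v x) a) ,
    trT _ _ (subst T (S-lift a (π v x)) (trap-contains-S trT Tx a)) (punchIn-step moved) ,
    π-lift _ _

  trapSet-projection : ∀ T → TrapSet f T → TrapSet (elim f v) (Image (π v) T)
  trapSet-projection T trT _ _ (x , Tx , refl) (k , moved , refl)
    with merge-≢ (lookup (π v x) k) _ _ (moved ∘ trans (lookup-elim (π v x) k))
  ... | inj₁ moved₀ = step-image trT Tx false moved₀
  ... | inj₂ moved₁ = step-image trT Tx true moved₁

  pair-cyclic-projection : ∀ {y c k} → Attractor f (Pair (lift y c) (lift (flip y k) c)) →
                           CyclicAttractor (elim f v) (Pair y (flip y k))
  pair-cyclic-projection {y} {c} {k} attr@(trP , _) =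
    pair-attractor {F = elim f v} trap (forth ◅ ε) (back ◅ ε) , not-singleton
    where
    y′ : State m
    y′ = flip y k
    P : StateSet (suc m)
    P = Pair (lift y c) (lift y′ c)
    over-c : ∀ {z b} → P (lift z b) → b ≡ c
    over-c (inj₁ eq) = proj₂ (lift-injective eq)
    over-c (inj₂ eq) = proj₂ (lift-injective eq)
    over-pair : ∀ {z b} → P (lift z b) → Pair y y′ z
    over-pair = map⊎ (proj₁ ∘ lift-injective) (proj₁ ∘ lift-injective)
    lift-pair : ∀ {w} → Pair y y′ w → P (lift w c)
    lift-pair = map⊎ (cong (λ u → lift u c)) (cong (λ u → lift u c))
    stable : ∀ {w} → Pair y y′ w → fᵥ w c ≡ c
    stable w∈ = stable-in-trap trP over-c (lift-pair w∈)
    trap : TrapSet (elim f v) (Pair y y′)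
    trap w _ w∈ t = over-pair (trP _ _ (lift-pair w∈) (elim-step⇒step (stable w∈) t))
    lifts-differ : lift y c ≢ lift y′ c
    lifts-differ eq = flip-≢ y k (sym (proj₁ (lift-injective eq)))
    forth : Trans (elim f v) y y′
    forth = step⇒elim-step (stable (inj₁ refl))
              (attractor-pair-step {F = f} attr (λ p → p) (inj₁ refl) (inj₂ refl) lifts-differ)
    back : Trans (elim f v) y′ y
    back = step⇒elim-step (stable (inj₂ refl))
             (attractor-pair-step {F = f} attr swap (inj₂ refl) (inj₁ refl) (lifts-differ ∘ sym))
    not-singleton : ¬ ∃ λ u → Pair y y′ ≐ Singleton u
    not-singleton (u , ⊆u , _) = flip-≢ y k (trans (⊆u (inj₂ refl)) (sym (⊆u (inj₁ refl))))

  cyclicAttractor-projection : ∀ x i → i ≢ v → CyclicAttractor f (Pair x (flip x i)) →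
                               CyclicAttractor (elim f v) (Pair (π v x) (π v (flip x i)))
  cyclicAttractor-projection x i i≢v (attr , _) with lift-view x | component-view i
  ... | _          | inj₁ i≡v       = contradiction i≡v i≢v
  ... | lifted y c | inj₂ (k , refl) rewrite flip-lift-punchIn y c k | π-lift y c | π-lift (flip y k) c =
    pair-cyclic-projection attr

  attractor-unique-over : ∀ At → Attractor (elim f v) At → ∀ A B → Attractor f A → Attractor f B →
    Intersects A (Preimage (π v) At) → Intersects B (Preimage (π v) At) → A ≐ B
  attractor-unique-over At attrAt A B attrA@(trA , _) attrB@(trB , _) (a , Aa , At-a) (b , Bb , At-b) =
    attractors-meeting⇒⊆ {F = f} attrA attrB zA zB , attractors-meeting⇒⊆ {F = f} attrB attrA zB zA
    where
    -- Both attractors contain S⁰(π b), since π(A) is a trap set for f̃ and so contains all of At.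
    πb∈πA : Image (π v) A (π v b)
    πb∈πA = trap-closed {F = elim f v} (trapSet-projection A trA) (a , Aa , refl) (attractor-connected {F = elim f v} attrAt At-a At-b)
    zA : A (S f v false (π v b))
    zA with πb∈πA
    ... | x , Ax , πx≡πb = subst (λ u → A (S f v false u)) πx≡πb (trap-contains-S trA Ax false)
    zB : B (S f v false (π v b))
    zB = trap-contains-S trB Bb false

theorem3p3 : ∀ (m : ℕ) (f : BN (suc m)) (v : Fin (suc m)) → ¬ PositiveLoop f v →
    -- (i)
    (∀ (x : State (suc m)) → FixedPoint f x →
        (x ≡ R f v false x × x ≡ R f v true x)
        × FixedPoint (elim f v) (π v x)
        × (∀ (y : State (suc m)) → FixedPoint f y → π v y ≡ π v x → y ≡ x))
    -- (ii)
    × (∀ (x : State (suc m)) → CyclicAttractor f (Pair x (flip x v)) →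
        FixedPoint (elim f v) (π v x))
    -- (iii)
    × (∀ (x : State m) → FixedPoint (elim f v) x →
        Attractor f (Pair (S f v false x) (S f v true x)))
    -- (iv)
    × (∀ (T : StateSet (suc m)) → TrapSet f T → TrapSet (elim f v) (Image (π v) T))
    -- (v)
    × (∀ (x : State (suc m)) (i : Fin (suc m)) → i ≢ v →
        CyclicAttractor f (Pair x (flip x i)) →
        CyclicAttractor (elim f v) (Pair (π v x) (π v (flip x i))))
    -- (vi)
    × (∀ (At : StateSet m) → Attractor (elim f v) At →
        ∀ (A B : StateSet (suc m)) → Attractor f A → Attractor f B →
        Intersects A (Preimage (π v) At) → Intersects B (Preimage (π v) At) →
        A ≐ B)
theorem3p3 m f v noLoop =
  fixedPoint-projection , v-cycle⇒elim-fixedPoint , elim-fixedPoint⇒attractor ,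
  trapSet-projection , cyclicAttractor-projection , attractor-unique-over
  where open Elimination f v noLoop
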